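{- Let $Q$ be a period $m$ sink-type quiver on $N$ nodes, with $B(1)=B_Q$ and $B(i+1)=\mu_iB(i)$. Then the quiver with matrix $C=B(1)+\rho^{ -1}B(2)\rho+\rho^{ -2}B(3)\rho^{2}+\cdots+\rho^{ -m+1}B(m)\rho^{m-1}$ has period $1$, i.e. $\mu_1C=\rho C\rho^{ -1}$.
   Context: A quiver on nodes $1,\dots,N$ (no loops, no $2$-cycles) is identified with the skew-symmetric integer matrix $B=(b_{ij})$, $b_{ij}$ = number of arrows $i\to j$ minus number $j\to i$; sums of quivers correspond to sums of matrices. Mutation at $k$: $\mu_kB=\tilde B$ with $\tilde b_{ij}=-b_{ij}$ if $i=k$ or $j=k$, else $\tilde b_{ij}=b_{ij}+\frac12(|b_{ik}|b_{kj}+b_{ik}|b_{kj}|)$. $\rho$: permutation matrix with $\rho_{i+1,i}=1$ ($1\le i\le N-1$), $\rho_{1,N}=1$, others $0$. Node $i$ is a sink if $b_{ij}\le0$ for all $j$. A quiver $Q$ is period $m$ sink-type if $B(m+1)=\rho^mB_Q\rho^{ -m}$ and node $i$ is a sink of $B(i)$ for each $1\le i\le m$. -}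

module Defs where

open import Data.Nat as ℕ using (ℕ; zero; suc)
open import Data.Fin using (Fin; zero; suc; toℕ; fromℕ<)
open import Data.Fin.Properties using (_≟_)
open import Data.Integer using (ℤ; +_; _+_; _*_; -_; ∣_∣; _≤_; 0ℤ; 1ℤ; _/_)
open import Data.Nat.Properties using (<⇒≤; <-≤-trans)
open import Data.Product using (_×_)
open import Relation.Nullary using (yes; no)
open import Relation.Binary.PropositionalEquality using (_≡_)

-- N × N integer matrices; node i (1 ≤ i ≤ N) of the paper is the index i-1 : Fin N.
Mat : ℕ → Set
Mat N = Fin N → Fin N → ℤ

_≈M_ : ∀ {N} → Mat N → Mat N → Set
A ≈M B = ∀ i j → A i j ≡ B i j

-- a quiver (no loops, no 2-cycles) is identified with a skew-symmetric integer matrix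
IsSkew : ∀ {N} → Mat N → Set
IsSkew B = ∀ i j → B i j ≡ - B j i

abs : ℤ → ℤ
abs x = + ∣ x ∣

sumFin : ∀ N → (Fin N → ℤ) → ℤ
sumFin zero f = 0ℤ
sumFin (suc N) f = f zero + sumFin N (λ i → f (suc i))

_⊕_ : ∀ {N} → Mat N → Mat N → Mat N
(A ⊕ B) i j = A i j + B i j

_⊗_ : ∀ {N} → Mat N → Mat N → Mat N
_⊗_ {N} A B i j = sumFin N (λ k → A i k * B k j)

zeroM : ∀ {N} → Mat N
zeroM i j = 0ℤ

idM : ∀ {N} → Mat N
idM i j with i ≟ j
... | yes _ = 1ℤ
... | no _ = 0ℤ

_^M_ : ∀ {N} → Mat N → ℕ → Mat N
A ^M zero = idM
A ^M suc k = A ⊗ (A ^M k)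

transpose : ∀ {N} → Mat N → Mat N
transpose A i j = A j i

μ : ∀ {N} → Fin N → Mat N → Mat N
μ k B i j with i ≟ k | j ≟ k
... | yes _ | _ = - B i j
... | no _ | yes _ = - B i j
... | no _ | no _ = B i j + ((abs (B i k) * B k j + B i k * abs (B k j)) / + 2)

-- ρ: ρ_{i+1,i} = 1 (1 ≤ i ≤ N-1), ρ_{1,N} = 1, other entries 0 (1-indexed).
-- In 0-indexed terms: ρ_{a,b} = 1 iff a ≡ b + 1 (mod N).
ρ : ∀ {N} → Mat N
ρ {suc n} zero b with toℕ b ℕ.≟ n
... | yes _ = 1ℤ
... | no _ = 0ℤ
ρ {suc n} (suc a) b with toℕ a ℕ.≟ toℕ b
... | yes _ = 1ℤ
... | no _ = 0ℤ

-- ρ is a permutation matrix, so its inverse is its transpose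
ρ⁻¹ : ∀ {N} → Mat N
ρ⁻¹ = transpose ρ

IsSink : ∀ {N} → Fin N → Mat N → Set
IsSink k B = ∀ j → B k j ≤ 0ℤ

-- mutSeq B i p = B(i+1) of the paper: B(1) = B, B(i+1) = μ_i B(i)
-- (the paper's node i is the index i-1 = fromℕ< _)
mutSeq : ∀ {N} → Mat N → (i : ℕ) → i ℕ.≤ N → Mat N
mutSeq B zero p = B
mutSeq B (suc i) p = μ (fromℕ< p) (mutSeq B i (<⇒≤ p))

-- period m sink-type (requires m ≤ N so that nodes 1..m exist)
PeriodSinkType : ∀ {N} → Mat N → (m : ℕ) → m ℕ.≤ N → Set
PeriodSinkType {N} B m m≤N =
  (mutSeq B m m≤N ≈M ((ρ ^M m) ⊗ (B ⊗ (ρ⁻¹ ^M m))))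
  × (∀ (i : ℕ) (i<m : i ℕ.< m) →
       IsSink (fromℕ< (<-≤-trans i<m m≤N)) (mutSeq B i (<⇒≤ (<-≤-trans i<m m≤N))))

sinkSum : ∀ {N} → Mat N → (m : ℕ) → m ℕ.≤ N → Mat N
sinkSum B zero p = zeroM
sinkSum B (suc k) p =
  sinkSum B k (<⇒≤ p) ⊕ ((ρ⁻¹ ^M k) ⊗ (mutSeq B k (<⇒≤ p) ⊗ (ρ ^M k)))

-- Write s for the cyclic successor on nodes.  Conjugation by ρᵏ shifts indices by k, so
-- C i j = Σ_{t<m} B(t+1)(sᵗ i, sᵗ j).  Every mutation in the sequence is at a sink, and mutating
-- a skew matrix at a sink only negates that node's row and column; hence
-- B(t+2)(sᵗ⁺¹ i, sᵗ⁺¹ j) = ± B(t+1)(sᵗ i, sᵗ j), with sign − exactly when i or j is node 1.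
-- Summing over t, the periodicity B(m+1) = ρᵐ B ρ⁻ᵐ closes the telescope and gives
-- (ρ C ρ⁻¹) i j = C(s⁻¹ i, s⁻¹ j) = ± C i j.  The same facts show that C is skew with node 1 a
-- sink, so μ₁ C is C with row and column 1 negated.
module Submission where

open import Defs
open import Data.Bool using (Bool; true; false; _∨_)
open import Data.Bool.Properties using (∨-comm)
open import Data.Fin using (Fin; zero; suc; toℕ; fromℕ; fromℕ<; inject₁; lower₁)
open import Data.Fin.Properties
  using (_≟_; suc-injective; toℕ-injective; toℕ-fromℕ; toℕ-fromℕ<; toℕ-lower₁; toℕ-inject₁;
         toℕ-inject₁-≢; inject₁-lower₁; lower₁-inject₁′)
open import Data.Integer using (ℤ; +_; -[1+_]; _+_; _*_; -_; 0ℤ; 1ℤ; _≤_; _/_; +≤+)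
open import Data.Integer.Properties
  using (*-identityˡ; *-zeroˡ; *-comm; +-identityˡ; +-identityʳ; +-comm; +-assoc;
         +-inverseʳ; +-mono-≤; neg-distrib-+; neg-distribʳ-*; neg-mono-≤; 0≤i⇒+∣i∣≡i;
         +-0-abelianGroup)
open import Algebra.Properties.AbelianGroup +-0-abelianGroup using (∙-cancelʳ)
open import Data.Nat as ℕ using (ℕ; zero; suc)
open import Data.Nat.GeneralisedArithmetic using (iterate)
open import Data.Nat.Properties using (<⇒≤; <-≤-trans; ≤-refl; ≤-irrelevant; <-irrefl)
open import Data.Product using (_,_)
open import Function using (_∘_; _⇔_; mk⇔; Equivalence)
open import Relation.Nullary using (yes; no; contradiction)
open import Relation.Nullary.Decidable using (does; does-⇔)
open import Relation.Binary.PropositionalEquality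
open ≡-Reasoning

iterate-suc : ∀ {A : Set} (f : A → A) x k → iterate f x (suc k) ≡ f (iterate f x k)
iterate-suc f x zero    = refl
iterate-suc f x (suc k) = iterate-suc f (f x) k

iterate-inverse : ∀ {A : Set} (f g : A → A) → (∀ x → g (f x) ≡ x) →
                  ∀ k x → iterate g (iterate f x k) k ≡ x
iterate-inverse f g g∘f≗id zero    x = refl
iterate-inverse f g g∘f≗id (suc k) x = begin
  iterate g (g (iterate f (f x) k)) k ≡⟨ cong (λ y → iterate g (g y) k) (iterate-suc f x k) ⟩
  iterate g (g (f (iterate f x k))) k ≡⟨ cong (λ y → iterate g y k) (g∘f≗id _) ⟩
  iterate g (iterate f x k) k         ≡⟨ iterate-inverse f g g∘f≗id k x ⟩
  x                                   ∎

idM-cong : ∀ {N M} {i j : Fin N} {i′ j′ : Fin M} → (i ≡ j) ⇔ (i′ ≡ j′) → idM i j ≡ idM i′ j′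
idM-cong {i = i} {j} {i′} {j′} i≡j⇔i′≡j′ with i ≟ j | i′ ≟ j′
... | yes _   | yes _     = refl
... | no _    | no _      = refl
... | yes i≡j | no i′≢j′  = contradiction (Equivalence.to i≡j⇔i′≡j′ i≡j) i′≢j′
... | no i≢j  | yes i′≡j′ = contradiction (Equivalence.from i≡j⇔i′≡j′ i′≡j′) i≢j

idM-sym : ∀ {N} (i j : Fin N) → idM i j ≡ idM j i
idM-sym i j = idM-cong (mk⇔ sym sym)

idM-transfer : ∀ {N} (f g : Fin N → Fin N) → (∀ x → g (f x) ≡ x) → (∀ y → f (g y) ≡ y) →
               ∀ x y → idM (f x) y ≡ idM x (g y)
idM-transfer f g g∘f≗id f∘g≗id x y =
  idM-cong (mk⇔ (λ fx≡y → trans (sym (g∘f≗id x)) (cong g fx≡y))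
                (λ x≡gy → trans (cong f x≡gy) (f∘g≗id y)))

sumFin-cong : ∀ N {f g : Fin N → ℤ} → (∀ k → f k ≡ g k) → sumFin N f ≡ sumFin N g
sumFin-cong zero    f≗g = refl
sumFin-cong (suc N) f≗g = cong₂ _+_ (f≗g zero) (sumFin-cong N (f≗g ∘ suc))

sumFin-zero : ∀ N (f : Fin N → ℤ) → (∀ k → f k ≡ 0ℤ) → sumFin N f ≡ 0ℤ
sumFin-zero zero    f f≗0 = refl
sumFin-zero (suc N) f f≗0 = cong₂ _+_ (f≗0 zero) (sumFin-zero N (f ∘ suc) (f≗0 ∘ suc))

sumFin-idM : ∀ N (c : Fin N) (g : Fin N → ℤ) → sumFin N (λ k → idM c k * g k) ≡ g c
sumFin-idM (suc N) zero g = begin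
  1ℤ * g zero + sumFin N (λ k → 0ℤ * g (suc k)) ≡⟨ cong₂ _+_ (*-identityˡ (g zero))
                                                     (sumFin-zero N _ (*-zeroˡ ∘ g ∘ suc)) ⟩
  g zero + 0ℤ                                     ≡⟨ +-identityʳ (g zero) ⟩
  g zero                                          ∎
sumFin-idM (suc N) (suc c) g = begin
  0ℤ * g zero + sumFin N (λ k → idM (suc c) (suc k) * g (suc k))
    ≡⟨ cong₂ _+_ (*-zeroˡ (g zero))
         (sumFin-cong N (λ k → cong (_* g (suc k))
            (idM-cong {i = suc c} {suc k} {c} {k} (mk⇔ suc-injective (cong suc))))) ⟩
  0ℤ + sumFin N (λ k → idM c k * g (suc k))
    ≡⟨ +-identityˡ _ ⟩
  sumFin N (λ k → idM c k * g (suc k))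
    ≡⟨ sumFin-idM N c (g ∘ suc) ⟩
  g (suc c) ∎

matrixOf : ∀ {N} → (Fin N → Fin N) → Mat N
matrixOf f i = idM (f i)

matrixOf-⊗ˡ : ∀ {N} {P : Mat N} {f : Fin N → Fin N} → P ≈M matrixOf f →
              ∀ A i j → (P ⊗ A) i j ≡ A (f i) j
matrixOf-⊗ˡ {N} {P} {f} P≈f A i j = begin
  sumFin N (λ k → P i k * A k j)        ≡⟨ sumFin-cong N (λ k → cong (_* A k j) (P≈f i k)) ⟩
  sumFin N (λ k → idM (f i) k * A k j)  ≡⟨ sumFin-idM N (f i) (λ k → A k j) ⟩
  A (f i) j                             ∎

matrixOf-⊗ʳ : ∀ {N} {Q : Mat N} (f g : Fin N → Fin N) → Q ≈M matrixOf g →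
              (∀ x → g (f x) ≡ x) → (∀ y → f (g y) ≡ y) →
              ∀ A i j → (A ⊗ Q) i j ≡ A i (f j)
matrixOf-⊗ʳ {N} {Q} f g Q≈g g∘f≗id f∘g≗id A i j = begin
  sumFin N (λ k → A i k * Q k j)
    ≡⟨ sumFin-cong N (λ k → trans (*-comm (A i k) _) (cong (_* A i k) (Q-entry k))) ⟩
  sumFin N (λ k → idM (f j) k * A i k)
    ≡⟨ sumFin-idM N (f j) (A i) ⟩
  A i (f j) ∎
  where
  Q-entry : ∀ k → Q k j ≡ idM (f j) k
  Q-entry k = trans (Q≈g k j) (trans (idM-transfer g f f∘g≗id g∘f≗id k j) (idM-sym k (f j)))

conjugate-matrixOf : ∀ {N} {P Q : Mat N} (f g : Fin N → Fin N) →
                     P ≈M matrixOf f → Q ≈M matrixOf g →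
                     (∀ x → g (f x) ≡ x) → (∀ y → f (g y) ≡ y) →
                     ∀ A i j → (P ⊗ (A ⊗ Q)) i j ≡ A (f i) (f j)
conjugate-matrixOf {Q = Q} f g P≈f Q≈g g∘f≗id f∘g≗id A i j =
  trans (matrixOf-⊗ˡ P≈f (A ⊗ Q) i j) (matrixOf-⊗ʳ f g Q≈g g∘f≗id f∘g≗id A (f i) j)

^M-matrixOf : ∀ {N} {P : Mat N} {f : Fin N → Fin N} → P ≈M matrixOf f →
              ∀ k → (P ^M k) ≈M matrixOf (λ i → iterate f i k)
^M-matrixOf P≈f zero    i j = refl
^M-matrixOf {P = P} {f} P≈f (suc k) i j =
  trans (matrixOf-⊗ˡ P≈f (P ^M k) i j) (^M-matrixOf P≈f k (f i) j)

transpose-matrixOf : ∀ {N} {P : Mat N} (f g : Fin N → Fin N) → P ≈M matrixOf f →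
                     (∀ x → g (f x) ≡ x) → (∀ y → f (g y) ≡ y) → transpose P ≈M matrixOf g
transpose-matrixOf f g P≈f g∘f≗id f∘g≗id i j =
  trans (P≈f j i) (trans (idM-transfer f g g∘f≗id f∘g≗id j i) (idM-sym j (g i)))

cyclicPred : ∀ {n} → Fin (suc n) → Fin (suc n)
cyclicPred {n} zero = fromℕ n
cyclicPred (suc i)  = inject₁ i

cyclicSuc : ∀ {n} → Fin (suc n) → Fin (suc n)
cyclicSuc {n} i with toℕ i ℕ.≟ n
... | yes _   = zero
... | no i≢n  = suc (lower₁ i (i≢n ∘ sym))

toℕ-cyclicSuc : ∀ {n} (i : Fin (suc n)) → toℕ i ≢ n → toℕ (cyclicSuc i) ≡ suc (toℕ i)
toℕ-cyclicSuc {n} i i≢n₀ with toℕ i ℕ.≟ n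
... | yes i≡n = contradiction i≡n i≢n₀
... | no i≢n  = cong suc (toℕ-lower₁ i (i≢n ∘ sym))

cyclicPred-cyclicSuc : ∀ {n} (i : Fin (suc n)) → cyclicPred (cyclicSuc i) ≡ i
cyclicPred-cyclicSuc {n} i with toℕ i ℕ.≟ n
... | yes i≡n = toℕ-injective (trans (toℕ-fromℕ n) (sym i≡n))
... | no i≢n  = inject₁-lower₁ i (i≢n ∘ sym)

cyclicSuc-cyclicPred : ∀ {n} (i : Fin (suc n)) → cyclicSuc (cyclicPred i) ≡ i
cyclicSuc-cyclicPred {n} zero with toℕ (fromℕ n) ℕ.≟ n
... | yes _  = refl
... | no ≢n  = contradiction (toℕ-fromℕ n) ≢n
cyclicSuc-cyclicPred {suc n} (suc i) with toℕ (inject₁ i) ℕ.≟ suc n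
... | yes ≡n = contradiction (sym ≡n) (toℕ-inject₁-≢ i)
... | no ≢n  = cong suc (lower₁-inject₁′ i (≢n ∘ sym))

ρ≈cyclicPred : ∀ {n} → ρ {suc n} ≈M matrixOf cyclicPred
ρ≈cyclicPred {n} zero j with toℕ j ℕ.≟ n | fromℕ n ≟ j
... | yes _   | yes _   = refl
... | no _    | no _    = refl
... | yes j≡n | no n≢j  = contradiction (toℕ-injective (trans (toℕ-fromℕ n) (sym j≡n))) n≢j
... | no j≢n  | yes n≡j = contradiction (trans (cong toℕ (sym n≡j)) (toℕ-fromℕ n)) j≢n
ρ≈cyclicPred (suc i) j with toℕ i ℕ.≟ toℕ j | inject₁ i ≟ j
... | yes _   | yes _   = refl
... | no _    | no _    = refl
... | yes i≡j | no i≢j  = contradiction (toℕ-injective (trans (toℕ-inject₁ i) i≡j)) i≢j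
... | no i≢j  | yes i≡j = contradiction (trans (sym (toℕ-inject₁ i)) (cong toℕ i≡j)) i≢j

ρ⁻¹≈cyclicSuc : ∀ {n} → ρ⁻¹ {suc n} ≈M matrixOf cyclicSuc
ρ⁻¹≈cyclicSuc = transpose-matrixOf cyclicPred cyclicSuc ρ≈cyclicPred cyclicSuc-cyclicPred cyclicPred-cyclicSuc

shift unshift : ∀ {n} → ℕ → Fin (suc n) → Fin (suc n)
shift k i   = iterate cyclicSuc i k
unshift k i = iterate cyclicPred i k

unshift-shift : ∀ {n} k (i : Fin (suc n)) → unshift k (shift k i) ≡ i
unshift-shift k = iterate-inverse cyclicSuc cyclicPred cyclicPred-cyclicSuc k

shift-unshift : ∀ {n} k (i : Fin (suc n)) → shift k (unshift k i) ≡ i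
shift-unshift k = iterate-inverse cyclicPred cyclicSuc cyclicSuc-cyclicPred k

ρ-conjugate : ∀ {n} (A : Mat (suc n)) i j → (ρ ⊗ (A ⊗ ρ⁻¹)) i j ≡ A (cyclicPred i) (cyclicPred j)
ρ-conjugate = conjugate-matrixOf cyclicPred cyclicSuc ρ≈cyclicPred ρ⁻¹≈cyclicSuc
                cyclicSuc-cyclicPred cyclicPred-cyclicSuc

ρ^-conjugate : ∀ {n} k (A : Mat (suc n)) i j →
               ((ρ ^M k) ⊗ (A ⊗ (ρ⁻¹ ^M k))) i j ≡ A (unshift k i) (unshift k j)
ρ^-conjugate k = conjugate-matrixOf (unshift k) (shift k)
                   (^M-matrixOf ρ≈cyclicPred k) (^M-matrixOf ρ⁻¹≈cyclicSuc k)
                   (shift-unshift k) (unshift-shift k)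

ρ⁻^-conjugate : ∀ {n} k (A : Mat (suc n)) i j →
                ((ρ⁻¹ ^M k) ⊗ (A ⊗ (ρ ^M k))) i j ≡ A (shift k i) (shift k j)
ρ⁻^-conjugate k = conjugate-matrixOf (shift k) (unshift k)
                    (^M-matrixOf ρ⁻¹≈cyclicSuc k) (^M-matrixOf ρ≈cyclicPred k)
                    (unshift-shift k) (shift-unshift k)

toℕ-shift-zero : ∀ {n} t → t ℕ.< suc n → toℕ (shift t (zero {n})) ≡ t
toℕ-shift-zero zero    t<N = refl
toℕ-shift-zero {n} (suc t) t+1<N = begin
  toℕ (shift (suc t) zero)       ≡⟨ cong toℕ (iterate-suc cyclicSuc zero t) ⟩
  toℕ (cyclicSuc (shift t zero)) ≡⟨ toℕ-cyclicSuc _ shift-t≢n ⟩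
  suc (toℕ (shift t zero))       ≡⟨ cong suc IH ⟩
  suc t                          ∎
  where
  IH : toℕ (shift t zero) ≡ t
  IH = toℕ-shift-zero t (<⇒≤ t+1<N)
  shift-t≢n : toℕ (shift t zero) ≢ n
  shift-t≢n t≡n = <-irrefl (trans (sym IH) t≡n) (ℕ.s≤s⁻¹ t+1<N)

shift-zero : ∀ {n} t (t<N : t ℕ.< suc n) → shift t zero ≡ fromℕ< t<N
shift-zero t t<N = toℕ-injective (trans (toℕ-shift-zero t t<N) (sym (toℕ-fromℕ< t<N)))

does-shift≟fromℕ< : ∀ {n} t (t<N : t ℕ.< suc n) (i : Fin (suc n)) →
                    does (shift t i ≟ fromℕ< t<N) ≡ does (i ≟ zero)
does-shift≟fromℕ< t t<N i = does-⇔ (mk⇔ to from) (shift t i ≟ fromℕ< t<N) (i ≟ zero)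
  where
  to : shift t i ≡ fromℕ< t<N → i ≡ zero
  to eq = begin
    i                        ≡⟨ unshift-shift t i ⟨
    unshift t (shift t i)    ≡⟨ cong (unshift t) (trans eq (sym (shift-zero t t<N))) ⟩
    unshift t (shift t zero) ≡⟨ unshift-shift t zero ⟩
    zero                     ∎
  from : i ≡ zero → shift t i ≡ fromℕ< t<N
  from refl = shift-zero t t<N

negateIf : Bool → ℤ → ℤ
negateIf true  x = - x
negateIf false x = x

negateIf-zero : ∀ b → negateIf b 0ℤ ≡ 0ℤ
negateIf-zero true  = refl
negateIf-zero false = refl

negateIf-+ : ∀ b x y → negateIf b (x + y) ≡ negateIf b x + negateIf b y
negateIf-+ true  = neg-distrib-+
negateIf-+ false x y = refl

negateIf-neg : ∀ b x → negateIf b (- x) ≡ - negateIf b x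
negateIf-neg true  x = refl
negateIf-neg false x = refl

inRowOrColumn : ∀ {N} → Fin N → Fin N → Fin N → Bool
inRowOrColumn k a b = does (a ≟ k) ∨ does (b ≟ k)

abs-nonpos : ∀ y → y ≤ 0ℤ → abs y ≡ - y
abs-nonpos (+ zero) _  = refl
abs-nonpos (+ suc k) (+≤+ ())
abs-nonpos -[1+ k ] _  = refl

mutation-term-vanishes : ∀ x y → 0ℤ ≤ x → y ≤ 0ℤ → (abs x * y + x * abs y) / + 2 ≡ 0ℤ
mutation-term-vanishes x y 0≤x y≤0 = cong (_/ + 2) (begin
  abs x * y + x * abs y ≡⟨ cong₂ (λ u v → u * y + x * v) (0≤i⇒+∣i∣≡i 0≤x) (abs-nonpos y y≤0) ⟩
  x * y + x * - y       ≡⟨ cong (_+_ (x * y)) (neg-distribʳ-* x y) ⟨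
  x * y + - (x * y)     ≡⟨ +-inverseʳ (x * y) ⟩
  0ℤ                    ∎)

-- Column k of a sink k of a skew matrix is ≥ 0, so b_ak ≥ 0 ≥ b_kb and the correction term vanishes.
μ-at-sink : ∀ {N} (k : Fin N) (X : Mat N) → IsSkew X → IsSink k X →
            ∀ a b → μ k X a b ≡ negateIf (inRowOrColumn k a b) (X a b)
μ-at-sink k X X-skew k-sink a b with a ≟ k | b ≟ k
... | yes _ | _     = refl
... | no _  | yes _ = refl
... | no _  | no _  = begin
  X a b + (abs (X a k) * X k b + X a k * abs (X k b)) / + 2
    ≡⟨ cong (_+_ (X a b)) (mutation-term-vanishes (X a k) (X k b) 0≤Xak (k-sink b)) ⟩
  X a b + 0ℤ
    ≡⟨ +-identityʳ (X a b) ⟩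
  X a b ∎
  where
  0≤Xak : 0ℤ ≤ X a k
  0≤Xak = subst (0ℤ ≤_) (sym (X-skew a k)) (neg-mono-≤ (k-sink a))

μ-at-sink-skew : ∀ {N} (k : Fin N) (X : Mat N) → IsSkew X → IsSink k X → IsSkew (μ k X)
μ-at-sink-skew k X X-skew k-sink a b = begin
  μ k X a b                                      ≡⟨ μ-at-sink k X X-skew k-sink a b ⟩
  negateIf (inRowOrColumn k a b) (X a b)         ≡⟨ cong₂ negateIf (∨-comm (does (a ≟ k)) _) (X-skew a b) ⟩
  negateIf (inRowOrColumn k b a) (- X b a)       ≡⟨ negateIf-neg (inRowOrColumn k b a) (X b a) ⟩
  - negateIf (inRowOrColumn k b a) (X b a)       ≡⟨ cong -_ (μ-at-sink k X X-skew k-sink b a) ⟨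
  - μ k X b a                                    ∎

mutSeq-irrelevant : ∀ {N} (B : Mat N) t (p q : t ℕ.≤ N) → mutSeq B t p ≡ mutSeq B t q
mutSeq-irrelevant B t p q = cong (mutSeq B t) (≤-irrelevant p q)

sinkSum-suc : ∀ {n} (B : Mat (suc n)) k (p : suc k ℕ.≤ suc n) i j →
              sinkSum B (suc k) p i j ≡ sinkSum B k (<⇒≤ p) i j + mutSeq B k (<⇒≤ p) (shift k i) (shift k j)
sinkSum-suc B k p i j = cong (_+_ (sinkSum B k (<⇒≤ p) i j)) (ρ⁻^-conjugate k (mutSeq B k (<⇒≤ p)) i j)

-- Σ_{t=1}^{k} B(t+1)(sᵗ x, sᵗ y): the sum defining C with each term moved one step along the mutation sequence.
shiftedSum : ∀ {n} (B : Mat (suc n)) k → k ℕ.≤ suc n → Mat (suc n)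
shiftedSum B zero    p x y = 0ℤ
shiftedSum B (suc k) p x y = shiftedSum B k (<⇒≤ p) x y + mutSeq B (suc k) p (shift (suc k) x) (shift (suc k) y)

sinkSum-telescope : ∀ {n} (B : Mat (suc n)) k (p : k ℕ.≤ suc n) x y →
                    sinkSum B k p x y + mutSeq B k p (shift k x) (shift k y) ≡ B x y + shiftedSum B k p x y
sinkSum-telescope B zero p x y = trans (+-identityˡ (B x y)) (sym (+-identityʳ (B x y)))
sinkSum-telescope B (suc k) p x y = begin
  sinkSum B (suc k) p x y + last                                      ≡⟨ cong (_+ last) (sinkSum-suc B k p x y) ⟩
  sinkSum B k (<⇒≤ p) x y + mutSeq B k (<⇒≤ p) (shift k x) (shift k y) + last
                                                                      ≡⟨ cong (_+ last) (sinkSum-telescope B k (<⇒≤ p) x y) ⟩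
  B x y + shiftedSum B k (<⇒≤ p) x y + last                           ≡⟨ +-assoc (B x y) _ last ⟩
  B x y + shiftedSum B (suc k) p x y                                  ∎
  where
  last : ℤ
  last = mutSeq B (suc k) p (shift (suc k) x) (shift (suc k) y)

periodic⇒sinkSum≡shiftedSum : ∀ {n} (B : Mat (suc n)) m (m≤N : m ℕ.≤ suc n) →
                              mutSeq B m m≤N ≈M ((ρ ^M m) ⊗ (B ⊗ (ρ⁻¹ ^M m))) →
                              sinkSum B m m≤N ≈M shiftedSum B m m≤N
periodic⇒sinkSum≡shiftedSum B m m≤N periodic x y = ∙-cancelʳ (B x y) _ _ (begin
  sinkSum B m m≤N x y + B x y                                     ≡⟨ cong (_+_ (sinkSum B m m≤N x y)) B-return ⟨
  sinkSum B m m≤N x y + mutSeq B m m≤N (shift m x) (shift m y)    ≡⟨ sinkSum-telescope B m m≤N x y ⟩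
  B x y + shiftedSum B m m≤N x y                                  ≡⟨ +-comm (B x y) _ ⟩
  shiftedSum B m m≤N x y + B x y                                  ∎)
  where
  B-return : mutSeq B m m≤N (shift m x) (shift m y) ≡ B x y
  B-return = begin
    mutSeq B m m≤N (shift m x) (shift m y)             ≡⟨ trans (periodic _ _) (ρ^-conjugate m B _ _) ⟩
    B (unshift m (shift m x)) (unshift m (shift m y))  ≡⟨ cong₂ B (unshift-shift m x) (unshift-shift m y) ⟩
    B x y                                              ∎

module SinkMutations {n} (B : Mat (suc n)) (B-skew : IsSkew B) (m : ℕ) (m≤N : m ℕ.≤ suc n)
  (sinks : ∀ (i : ℕ) (i<m : i ℕ.< m) →
           IsSink (fromℕ< (<-≤-trans i<m m≤N)) (mutSeq B i (<⇒≤ (<-≤-trans i<m m≤N))))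
  where

  sink : ∀ t (t<m : t ℕ.< m) (q : t ℕ.≤ suc n) → IsSink (fromℕ< (<-≤-trans t<m m≤N)) (mutSeq B t q)
  sink t t<m q = subst (IsSink _) (mutSeq-irrelevant B t _ q) (sinks t t<m)

  mutSeq-skew : ∀ t → t ℕ.≤ m → (q : t ℕ.≤ suc n) → IsSkew (mutSeq B t q)
  mutSeq-skew zero    _     q = B-skew
  mutSeq-skew (suc t) t<m q =
    μ-at-sink-skew (fromℕ< q) _ (mutSeq-skew t (<⇒≤ t<m) (<⇒≤ q)) (sink t t<m (<⇒≤ q))

  mutSeq-suc : ∀ t → t ℕ.< m → (q : suc t ℕ.≤ suc n) → ∀ a b →
               mutSeq B (suc t) q a b ≡ negateIf (inRowOrColumn (fromℕ< q) a b) (mutSeq B t (<⇒≤ q) a b)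
  mutSeq-suc t t<m q = μ-at-sink (fromℕ< q) _ (mutSeq-skew t (<⇒≤ t<m) (<⇒≤ q)) (sink t t<m (<⇒≤ q))

  sinkSum-skew : ∀ k → k ℕ.≤ m → (q : k ℕ.≤ suc n) → IsSkew (sinkSum B k q)
  sinkSum-skew zero    _   q i j = refl
  sinkSum-skew (suc k) k<m p i j = begin
    sinkSum B (suc k) p i j                       ≡⟨ sinkSum-suc B k p i j ⟩
    S i j + X (shift k i) (shift k j)             ≡⟨ cong₂ _+_ (sinkSum-skew k (<⇒≤ k<m) (<⇒≤ p) i j)
                                                                (mutSeq-skew k (<⇒≤ k<m) (<⇒≤ p) _ _) ⟩
    - S j i + - X (shift k j) (shift k i)         ≡⟨ neg-distrib-+ (S j i) _ ⟨
    - (S j i + X (shift k j) (shift k i))         ≡⟨ cong -_ (sinkSum-suc B k p j i) ⟨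
    - sinkSum B (suc k) p j i                     ∎
    where
    S X : Mat (suc n)
    S = sinkSum B k (<⇒≤ p)
    X = mutSeq B k (<⇒≤ p)

  sinkSum-sink-zero : ∀ k → k ℕ.≤ m → (q : k ℕ.≤ suc n) → IsSink zero (sinkSum B k q)
  sinkSum-sink-zero zero    _   q j = +≤+ ℕ.z≤n
  sinkSum-sink-zero (suc k) k<m p j =
    subst (_≤ 0ℤ) (sym (sinkSum-suc B k p zero j))
      (+-mono-≤ (sinkSum-sink-zero k (<⇒≤ k<m) (<⇒≤ p) j)
                (subst (λ s → mutSeq B k (<⇒≤ p) s (shift k j) ≤ 0ℤ) (sym (shift-zero k p))
                       (sink k k<m (<⇒≤ p) (shift k j))))

  shiftedSum-cyclicPred : ∀ k → k ℕ.≤ m → (q : k ℕ.≤ suc n) → ∀ i j →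
                          shiftedSum B k q (cyclicPred i) (cyclicPred j)
                            ≡ negateIf (inRowOrColumn zero i j) (sinkSum B k q i j)
  shiftedSum-cyclicPred zero    _   q i j = sym (negateIf-zero (inRowOrColumn zero i j))
  shiftedSum-cyclicPred (suc k) k<m p i j = begin
    shiftedSum B (suc k) p (cyclicPred i) (cyclicPred j)
      ≡⟨ cong₂ _+_ (shiftedSum-cyclicPred k (<⇒≤ k<m) (<⇒≤ p) i j)
                   (cong₂ (mutSeq B (suc k) p) (cong (shift k) (cyclicSuc-cyclicPred i))
                                               (cong (shift k) (cyclicSuc-cyclicPred j))) ⟩
    ε (S i j) + mutSeq B (suc k) p (shift k i) (shift k j)
      ≡⟨ cong (_+_ (ε (S i j))) (mutSeq-suc k k<m p (shift k i) (shift k j)) ⟩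
    ε (S i j) + negateIf (inRowOrColumn (fromℕ< p) (shift k i) (shift k j)) (X (shift k i) (shift k j))
      ≡⟨ cong (λ b → ε (S i j) + negateIf b (X (shift k i) (shift k j)))
              (cong₂ _∨_ (does-shift≟fromℕ< k p i) (does-shift≟fromℕ< k p j)) ⟩
    ε (S i j) + ε (X (shift k i) (shift k j))
      ≡⟨ negateIf-+ (inRowOrColumn zero i j) _ _ ⟨
    ε (S i j + X (shift k i) (shift k j))
      ≡⟨ cong ε (sinkSum-suc B k p i j) ⟨
    ε (sinkSum B (suc k) p i j) ∎
    where
    ε : ℤ → ℤ
    ε = negateIf (inRowOrColumn zero i j)
    S X : Mat (suc n)
    S = sinkSum B k (<⇒≤ p)
    X = mutSeq B k (<⇒≤ p)

mainTheorem9 : (n : ℕ) (B : Mat (suc n)) → IsSkew B → (m : ℕ) (m≤N : m ℕ.≤ suc n) → PeriodSinkType B m m≤N → μ zero (sinkSum B m m≤N) ≈M (ρ ⊗ (sinkSum B m m≤N ⊗ ρ⁻¹))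
mainTheorem9 n B B-skew m m≤N (periodic , sinks) i j = begin
  μ zero C i j                                      ≡⟨ μ-at-sink zero C (sinkSum-skew m ≤-refl m≤N)
                                                                        (sinkSum-sink-zero m ≤-refl m≤N) i j ⟩
  negateIf (inRowOrColumn zero i j) (C i j)         ≡⟨ shiftedSum-cyclicPred m ≤-refl m≤N i j ⟨
  shiftedSum B m m≤N (cyclicPred i) (cyclicPred j)  ≡⟨ periodic⇒sinkSum≡shiftedSum B m m≤N periodic _ _ ⟨
  C (cyclicPred i) (cyclicPred j)                   ≡⟨ ρ-conjugate C i j ⟨
  (ρ ⊗ (C ⊗ ρ⁻¹)) i j                              ∎
  where
  open SinkMutations B B-skew m m≤N sinks
  C : Mat (suc n)
  C = sinkSum B m m≤N
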